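{- Let $M$ be an algebraic $\lambda$-term. If $M$ is weakly solvable, then there exists $s\in\mathcal T^*(M)$ such that $\mathrm{NF}(s)\neq0$.
   Context: Resource terms $s::=x\mid\lambda x.s\mid\langle s\rangle\bar t$, monomials $\bar t=[t_1..t_n]$ finite multisets of resource terms, up to $\alpha$; finite formal sums with linearly extended constructors; multilinear substitution $e\langle\bar u/x\rangle=\sum_f e[u_1/x_{f(1)},\dots,u_n/x_{f(n)}]$ over bijections $f$ from $\{1..n\}$ to the free occurrences of $x$ in $e$ ($0$ if counts differ). Resource reduction $\to_r$: contextual closure of $\langle\lambda x.s\rangle\bar t\to_r s\langle\bar t/x\rangle$; $\mathrm{NF}(s)$ is the unique normal form of $s$ (a finite sum of resource terms without such redexes). $\mathcal S$ is a commutative semiring. Algebraic $\lambda$-terms $M::=x\mid\lambda x.M\mid(M)N\mid0\mid a\cdot M\mid M+N$ up to $\alpha$ and the congruence generated by $\lambda x.0=0$, $\lambda x.(a\cdot M)=a\cdot\lambda x.M$, $\lambda x.(M+N)=\lambda x.M+\lambda x.N$, $(0)P=0$, $(a\cdot M)P=a\cdot(M)P$, $(M+N)P=(M)P+(N)P$; canonical forms $M::=S\mid0\mid a\cdot M\mid M+N$, $S::=x\mid\lambda x.S\mid(S)M$. Taylor support $\mathcal T^*$: $\{x\}$; $\{\lambda x.s:s\in\mathcal T^*(M)\}$; $\{\langle s\rangle[t_1..t_n]:s\in\mathcal T^*(M),n\ge0,t_i\in\mathcal T^*(N)\}$ for $(M)N$; $\emptyset$; $\mathcal T^*(M)$ for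 $a\cdot M$; $\mathcal T^*(M)\cup\mathcal T^*(N)$. Weak solvability $\mathrm{ws}(M)$ is derived by: $\mathrm{ws}((x)M_1\cdots M_n)$; $\mathrm{ws}(S)\Rightarrow\mathrm{ws}(\lambda x.S)$; $\mathrm{ws}((S[M_0/x])M_1\cdots M_n)\Rightarrow\mathrm{ws}((\lambda x.S)M_0M_1\cdots M_n)$ (capture-avoiding substitution); $\mathrm{ws}(M)\Rightarrow\mathrm{ws}(a\cdot M)$; $\mathrm{ws}(M)\Rightarrow\mathrm{ws}(M+N)$; $\mathrm{ws}(N)\Rightarrow\mathrm{ws}(M+N)$. -}

module Defs where

open import Level using (Level)
open import Data.Nat using (ℕ; zero; suc; _<ᵇ_; _≡ᵇ_; pred)
open import Data.Bool using (Bool; true; false; if_then_else_)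
open import Data.List using (List; []; _∷_; _++_; map; concatMap; [_])
open import Data.List.Relation.Unary.All using (All)
open import Data.Product using (_×_; _,_; Σ)
open import Relation.Binary.PropositionalEquality using (_≡_; _≢_)
open import Relation.Binary.Construct.Closure.ReflexiveTransitive using (Star)

-- Resource terms (de Bruijn indices, so terms are taken up to α).
-- A monomial [t₁..tₙ] is represented by a list; all notions below are
-- invariant under permutation of monomials.

data RTerm : Set where
  var : ℕ → RTerm
  lam : RTerm → RTerm
  app : RTerm → List RTerm → RTerm

Monomial : Set
Monomial = List RTerm

-- finite formal sums of resource terms (ℕ-linear combinations);
-- the empty list is the sum 0
RSum : Set
RSum = List RTerm

MSum : Set
MSum = List Monomial

mutual
  shiftR : ℕ → RTerm → RTerm
  shiftR c (var n) = if n <ᵇ c then var n else var (suc n)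
  shiftR c (lam s) = lam (shiftR (suc c) s)
  shiftR c (app s ts) = app (shiftR c s) (shiftRs c ts)

  shiftRs : ℕ → Monomial → Monomial
  shiftRs c [] = []
  shiftRs c (t ∷ ts) = shiftR c t ∷ shiftRs c ts

splits : {A : Set} → List A → List (List A × List A)
splits [] = [ ([] , []) ]
splits (x ∷ xs) = concatMap (λ { (l , r) → (x ∷ l , r) ∷ (l , x ∷ r) ∷ [] }) (splits xs)

appSum : RSum → MSum → RSum
appSum S TS = concatMap (λ s → map (app s) TS) S

consSum : RSum → MSum → MSum
consSum T TS = concatMap (λ t → map (t ∷_) TS) T

-- Multilinear substitution  e⟨ū/k⟩  (index k is replaced, indices > k are
-- decremented; ū lives in the context of the result).  The sum over
-- bijections f from positions of ū to occurrences of k is computed by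
-- distributing the elements of ū among the immediate subterms in all
-- possible ways; it is 0 (empty sum) when the counts differ.
mutual
  substR : ℕ → Monomial → RTerm → RSum
  substR k us (var n) with n ≡ᵇ k | n <ᵇ k | us
  ... | true  | _     | u ∷ [] = [ u ]
  ... | true  | _     | _      = []
  ... | false | true  | []     = [ var n ]
  ... | false | false | []     = [ var (pred n) ]
  ... | false | _     | _ ∷ _  = []
  substR k us (lam s) = map lam (substR (suc k) (shiftRs 0 us) s)
  substR k us (app s ts) =
    concatMap (λ { (l , r) → appSum (substR k l s) (substRs k r ts) }) (splits us)

  substRs : ℕ → Monomial → Monomial → MSum
  substRs k [] [] = [ [] ]
  substRs k (_ ∷ _) [] = []
  substRs k us (t ∷ ts) =
    concatMap (λ { (l , r) → consSum (substR k l t) (substRs k r ts) }) (splits us)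

-- Resource reduction: contextual closure of ⟨λx.s⟩t̄ →r s⟨t̄/x⟩,
-- a term reduces to a sum (constructors extended linearly).
mutual
  data _⟶r_ : RTerm → RSum → Set where
    β    : ∀ {s ts} → app (lam s) ts ⟶r substR 0 ts s
    ξlam : ∀ {s S} → s ⟶r S → lam s ⟶r map lam S
    ξappL : ∀ {s S ts} → s ⟶r S → app s ts ⟶r map (λ s′ → app s′ ts) S
    ξappR : ∀ {s ts TS} → ts ⟶m TS → app s ts ⟶r map (app s) TS

  data _⟶m_ : Monomial → MSum → Set where
    here  : ∀ {t T ts} → t ⟶r T → (t ∷ ts) ⟶m map (_∷ ts) T
    there : ∀ {t ts TS} → ts ⟶m TS → (t ∷ ts) ⟶m map (t ∷_) TS

data _⇒r_ : RSum → RSum → Set where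
  step : ∀ S₁ S₂ {s T} → s ⟶r T → (S₁ ++ s ∷ S₂) ⇒r (S₁ ++ T ++ S₂)

_⇒r*_ : RSum → RSum → Set
_⇒r*_ = Star _⇒r_

mutual
  data RedexFree : RTerm → Set where
    var : ∀ {n} → RedexFree (var n)
    lam : ∀ {s} → RedexFree s → RedexFree (lam s)
    app : ∀ {s ts} → (∀ {u} → s ≢ lam u) → RedexFree s → RedexFreeM ts →
          RedexFree (app s ts)

  data RedexFreeM : Monomial → Set where
    []  : RedexFreeM []
    _∷_ : ∀ {t ts} → RedexFree t → RedexFreeM ts → RedexFreeM (t ∷ ts)

NormalSum : RSum → Set
NormalSum S = All RedexFree S

IsNF : RTerm → RSum → Set
IsNF s S = ([ s ] ⇒r* S) × NormalSum S

NFNonZero : RTerm → Set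
NFNonZero s = Σ RSum (λ S → IsNF s S × S ≢ [])

data ATerm {a : Level} (A : Set a) : Set a where
  var  : ℕ → ATerm A
  lam  : ATerm A → ATerm A
  app  : ATerm A → ATerm A → ATerm A
  𝟘    : ATerm A
  _·_  : A → ATerm A → ATerm A
  _⊕_  : ATerm A → ATerm A → ATerm A

module _ {a : Level} {A : Set a} where

  shiftA : ℕ → ATerm A → ATerm A
  shiftA c (var n) = if n <ᵇ c then var n else var (suc n)
  shiftA c (lam M) = lam (shiftA (suc c) M)
  shiftA c (app M N) = app (shiftA c M) (shiftA c N)
  shiftA c 𝟘 = 𝟘
  shiftA c (x · M) = x · shiftA c M
  shiftA c (M ⊕ N) = shiftA c M ⊕ shiftA c N

  substA : ℕ → ATerm A → ATerm A → ATerm A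
  substA k N (var n) = if n ≡ᵇ k then N else (if n <ᵇ k then var n else var (pred n))
  substA k N (lam M) = lam (substA (suc k) (shiftA 0 N) M)
  substA k N (app M P) = app (substA k N M) (substA k N P)
  substA k N 𝟘 = 𝟘
  substA k N (x · M) = x · substA k N M
  substA k N (M ⊕ P) = substA k N M ⊕ substA k N P

  apps : ATerm A → List (ATerm A) → ATerm A
  apps M [] = M
  apps M (N ∷ Ns) = apps (app M N) Ns

  infix 4 _≈A_
  data _≈A_ : ATerm A → ATerm A → Set a where
    ≈refl  : ∀ {M} → M ≈A M
    ≈sym   : ∀ {M N} → M ≈A N → N ≈A M
    ≈trans : ∀ {M N P} → M ≈A N → N ≈A P → M ≈A P
    ≈lam   : ∀ {M N} → M ≈A N → lam M ≈A lam N
    ≈app   : ∀ {M M′ N N′} → M ≈A M′ → N ≈A N′ → app M N ≈A app M′ N′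
    ≈scal  : ∀ {x M N} → M ≈A N → x · M ≈A x · N
    ≈plus  : ∀ {M M′ N N′} → M ≈A M′ → N ≈A N′ → M ⊕ N ≈A M′ ⊕ N′
    lam-0  : lam 𝟘 ≈A 𝟘
    lam-·  : ∀ {x M} → lam (x · M) ≈A x · lam M
    lam-⊕  : ∀ {M N} → lam (M ⊕ N) ≈A lam M ⊕ lam N
    app-0  : ∀ {P} → app 𝟘 P ≈A 𝟘
    app-·  : ∀ {x M P} → app (x · M) P ≈A x · app M P
    app-⊕  : ∀ {M N P} → app (M ⊕ N) P ≈A app M P ⊕ app N P

  data Simple : ATerm A → Set a where
    var : ∀ {n} → Simple (var n)
    lam : ∀ {S} → Simple S → Simple (lam S)
    app : ∀ {S M} → Simple S → Simple (app S M)

  -- weak solvability (on terms up to the congruence: closed under ≈A)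
  data WS : ATerm A → Set a where
    ws-head : ∀ {x Ms} → WS (apps (var x) Ms)
    ws-lam  : ∀ {S} → Simple S → WS S → WS (lam S)
    ws-β    : ∀ {S M₀ Ms} → Simple S → WS (apps (substA 0 M₀ S) Ms) →
              WS (apps (app (lam S) M₀) Ms)
    ws-·    : ∀ {x M} → WS M → WS (x · M)
    ws-⊕l   : ∀ {M N} → WS M → WS (M ⊕ N)
    ws-⊕r   : ∀ {M N} → WS N → WS (M ⊕ N)
    ws-≈    : ∀ {M N} → M ≈A N → WS M → WS N

  data _∈T*_ : RTerm → ATerm A → Set a where
    var : ∀ {n} → var n ∈T* var n
    lam : ∀ {s M} → s ∈T* M → lam s ∈T* lam M
    app : ∀ {s ts M N} → s ∈T* M → All (_∈T* N) ts → app s ts ∈T* app M N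
    scal : ∀ {s x M} → s ∈T* M → s ∈T* (x · M)
    plusl : ∀ {s M N} → s ∈T* M → s ∈T* (M ⊕ N)
    plusr : ∀ {s M N} → s ∈T* N → s ∈T* (M ⊕ N)

{-# OPTIONS --safe #-}
module Submission where

-- A head normal form (x)M₁⋯Mₙ contains the
-- normal term ⟨x⟩[]⋯[] in its Taylor support.  For a head β-step, an element
-- s′ of 𝒯*((S[M₀/x])M₁⋯Mₙ) with NF(s′) ≠ 0 occurs in s⟨t̄/x⟩t̄₁⋯t̄ₙ for some
-- s ∈ 𝒯*(S) and t̄ ⊆ 𝒯*(M₀), so s′ is a summand of the one-step reduct of
-- ⟨λx.s⟩t̄ t̄₁⋯t̄ₙ ∈ 𝒯*((λx.S)M₀M₁⋯Mₙ).  Resource sums have coefficients in ℕ,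
-- so normalising the other summands (possible since resource reduction
-- decreases size) cannot cancel NF(s′).  The Taylor support is invariant
-- under the linearity congruence, and the remaining cases are immediate.

open import Defs
open import Level using (Level)
open import Algebra.Bundles using (CommutativeSemiring)
open import Algebra.Properties.CommutativeSemigroup as CSemigroup using ()
open import Data.Bool using (true; false; if_then_else_)
open import Data.List using (List; []; _∷_; _++_; map; concatMap; [_])
open import Data.List.Properties using (++-identityʳ; ++-assoc; ++-conicalˡ; ++-conicalʳ; map-++; map-id; map-∘)
open import Data.List.Membership.Propositional using (_∈_; lose)
open import Data.List.Membership.Propositional.Properties using (∈-∃++; ∈-map⁺; ∈-concatMap⁺)
open import Data.List.Relation.Binary.Pointwise using (Pointwise; []; _∷_)
open import Data.List.Relation.Unary.All as All using (All; []; _∷_)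
open import Data.List.Relation.Unary.All.Properties using (map⁺; ++⁺; concat⁺)
open import Data.List.Relation.Unary.Any using (here; there)
open import Data.Nat using (ℕ; suc; _+_; _≤_; _<_; s≤s; z≤n; _<ᵇ_; _≡ᵇ_; pred)
open import Data.Nat.Properties using (+-assoc; +-commutativeSemigroup; ≤-refl; ≤-reflexive; ≤-trans; <-≤-trans; m≤m+n; m≤n⇒m≤1+n; n≤1+n; +-mono-≤; +-monoˡ-≤; +-monoˡ-<; +-monoʳ-<)
open import Data.Product using (Σ; _×_; _,_; ∃; ∃₂)
open import Data.Sum using (_⊎_; inj₁; inj₂)
open import Function using (_∘_)
open import Relation.Binary.PropositionalEquality hiding ([_])
open import Relation.Binary.Construct.Closure.ReflexiveTransitive using (ε; _◅_; _◅◅_; gmap)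

open CSemigroup +-commutativeSemigroup using (interchange; x∙yz≈y∙xz)

All-concatMap : ∀ {X Y : Set} {P : Y → Set} {f : X → List Y} {xs} →
                All (All P ∘ f) xs → All P (concatMap f xs)
All-concatMap = concat⁺ ∘ map⁺

∈-concatMap : ∀ {X Y : Set} {f : X → List Y} {x xs y} → x ∈ xs → y ∈ f x → y ∈ concatMap f xs
∈-concatMap x∈xs y∈fx = ∈-concatMap⁺ _ (lose x∈xs y∈fx)

module _ {X Y Z : Set} where

  All-concatMap-map : ∀ (g : X → Y → Z) {P : X → Set} {Q : Y → Set} {R : Z → Set} {xs ys} →
                      All P xs → All Q ys → (∀ {x y} → P x → Q y → R (g x y)) →
                      All R (concatMap (λ x → map (g x) ys) xs)
  All-concatMap-map g ps qs h = All-concatMap (All.map (λ p → map⁺ (All.map (h p) qs)) ps)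

  ∈-concatMap-map : ∀ (g : X → Y → Z) {x xs y ys} → x ∈ xs → y ∈ ys →
                    g x y ∈ concatMap (λ x → map (g x) ys) xs
  ∈-concatMap-map g x∈xs y∈ys = ∈-concatMap x∈xs (∈-map⁺ (g _) y∈ys)

map-≡[] : ∀ {X Y : Set} {f : X → Y} xs → map f xs ≡ [] → xs ≡ []
map-≡[] [] _ = refl

∈-splits-++ : ∀ {X : Set} (l r : List X) → (l , r) ∈ splits (l ++ r)
∈-splits-++ []      []      = here refl
∈-splits-++ []      (x ∷ r) = ∈-concatMap (∈-splits-++ [] r) (there (here refl))
∈-splits-++ (x ∷ l) r       = ∈-concatMap (∈-splits-++ l r) (here refl)

mutual
  size : RTerm → ℕ
  size (var _)    = 1
  size (lam s)    = suc (size s)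
  size (app s ts) = suc (size s + sizeM ts)

  sizeM : Monomial → ℕ
  sizeM []       = 0
  sizeM (t ∷ ts) = size t + sizeM ts

mutual
  size-shiftR : ∀ c t → size (shiftR c t) ≡ size t
  size-shiftR c (var n) with n <ᵇ c
  ... | true  = refl
  ... | false = refl
  size-shiftR c (lam s)    = cong suc (size-shiftR (suc c) s)
  size-shiftR c (app s ts) = cong suc (cong₂ _+_ (size-shiftR c s) (sizeM-shiftRs c ts))

  sizeM-shiftRs : ∀ c ts → sizeM (shiftRs c ts) ≡ sizeM ts
  sizeM-shiftRs c []       = refl
  sizeM-shiftRs c (t ∷ ts) = cong₂ _+_ (size-shiftR c t) (sizeM-shiftRs c ts)

sizeM-splits : ∀ us → All (λ (l , r) → sizeM l + sizeM r ≡ sizeM us) (splits us)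
sizeM-splits []       = refl ∷ []
sizeM-splits (u ∷ us) = All-concatMap (All.map (λ {(l , r)} → both-sides l r) (sizeM-splits us))
  where
  both-sides : ∀ l r → sizeM l + sizeM r ≡ sizeM us →
               All (λ (l′ , r′) → sizeM l′ + sizeM r′ ≡ sizeM (u ∷ us))
                   ((u ∷ l , r) ∷ (l , u ∷ r) ∷ [])
  both-sides l r eq = trans (+-assoc (size u) (sizeM l) (sizeM r)) (cong (size u +_) eq)
                    ∷ trans (x∙yz≈y∙xz (sizeM l) (size u) (sizeM r)) (cong (size u +_) eq)
                    ∷ []

All-concatMap-splits : ∀ {Y : Set} {P : Y → Set} us (f : Monomial × Monomial → List Y) →
                       (∀ l r → sizeM l + sizeM r ≡ sizeM us → All P (f (l , r))) →
                       All P (concatMap f (splits us))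
All-concatMap-splits us f h = All-concatMap (All.map (λ {(l , r)} → h l r) (sizeM-splits us))

+-mono-≤-split : ∀ {a b} m n l r {u} → a ≤ m + l → b ≤ n + r → l + r ≡ u → a + b ≤ (m + n) + u
+-mono-≤-split m n l r p q refl =
  ≤-trans (+-mono-≤ p q) (≤-reflexive (interchange m l n r))

substRs-∷ : ∀ k us t ts → substRs k us (t ∷ ts) ≡
            concatMap (λ (l , r) → consSum (substR k l t) (substRs k r ts)) (splits us)
substRs-∷ k []      t ts = refl
substRs-∷ k (_ ∷ _) t ts = refl

mutual
  size-substR : ∀ k us t → All (λ u → size u ≤ size t + sizeM us) (substR k us t)
  size-substR k us (var n) with n ≡ᵇ k | n <ᵇ k | us
  ... | true  | _     | u ∷ []    = m≤n⇒m≤1+n (m≤m+n (size u) 0) ∷ []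
  ... | true  | _     | []        = []
  ... | true  | _     | _ ∷ _ ∷ _ = []
  ... | false | true  | []        = ≤-refl ∷ []
  ... | false | false | []        = ≤-refl ∷ []
  ... | false | true  | _ ∷ _     = []
  ... | false | false | _ ∷ _     = []
  size-substR k us (lam s) =
    map⁺ (All.map (λ p → s≤s (≤-trans p (≤-reflexive (cong (size s +_) (sizeM-shiftRs 0 us)))))
                  (size-substR (suc k) (shiftRs 0 us) s))
  size-substR k us (app s ts) = All-concatMap-splits us _ λ l r eq →
    All-concatMap-map app (size-substR k l s) (size-substRs k r ts) λ p q →
      s≤s (+-mono-≤-split (size s) (sizeM ts) (sizeM l) (sizeM r) p q eq)

  size-substRs : ∀ k us ts → All (λ vs → sizeM vs ≤ sizeM ts + sizeM us) (substRs k us ts)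
  size-substRs k [] []      = z≤n ∷ []
  size-substRs k (_ ∷ _) [] = []
  size-substRs k us (t ∷ ts) rewrite substRs-∷ k us t ts = All-concatMap-splits us _ λ l r eq →
    All-concatMap-map _∷_ (size-substR k l t) (size-substRs k r ts) λ p q →
      +-mono-≤-split (size t) (sizeM ts) (sizeM l) (sizeM r) p q eq

mutual
  size-⟶r : ∀ {t T} → t ⟶r T → All (λ u → size u < size t) T
  size-⟶r {app (lam s) ts} β =
    All.map (λ p → s≤s (≤-trans p (+-monoˡ-≤ (sizeM ts) (n≤1+n (size s))))) (size-substR 0 ts s)
  size-⟶r (ξlam st) = map⁺ (All.map s≤s (size-⟶r st))
  size-⟶r {app s ts} (ξappL st) = map⁺ (All.map (λ p → s≤s (+-monoˡ-< (sizeM ts) p)) (size-⟶r st))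
  size-⟶r {app s ts} (ξappR st) = map⁺ (All.map (λ p → s≤s (+-monoʳ-< (size s) p)) (sizeM-⟶m st))

  sizeM-⟶m : ∀ {ts TS} → ts ⟶m TS → All (λ vs → sizeM vs < sizeM ts) TS
  sizeM-⟶m {t ∷ ts} (here st)  = map⁺ (All.map (+-monoˡ-< (sizeM ts)) (size-⟶r st))
  sizeM-⟶m {t ∷ ts} (there st) = map⁺ (All.map (+-monoʳ-< (size t)) (sizeM-⟶m st))

mutual
  progress : ∀ t → RedexFree t ⊎ ∃ (t ⟶r_)
  progress (var n) = inj₁ var
  progress (lam s) with progress s
  ... | inj₁ nf      = inj₁ (lam nf)
  ... | inj₂ (_ , r) = inj₂ (_ , ξlam r)
  progress (app (lam s) ts) = inj₂ (_ , β)
  progress (app (var n) ts) with progressM ts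
  ... | inj₁ nf      = inj₁ (app (λ ()) var nf)
  ... | inj₂ (_ , r) = inj₂ (_ , ξappR r)
  progress (app (app s us) ts) with progress (app s us) | progressM ts
  ... | inj₂ (_ , r) | _            = inj₂ (_ , ξappL r)
  ... | inj₁ nf      | inj₁ nfs     = inj₁ (app (λ ()) nf nfs)
  ... | inj₁ _       | inj₂ (_ , r) = inj₂ (_ , ξappR r)

  progressM : ∀ ts → RedexFreeM ts ⊎ ∃ (ts ⟶m_)
  progressM [] = inj₁ []
  progressM (t ∷ ts) with progress t | progressM ts
  ... | inj₂ (_ , r) | _            = inj₂ (_ , here r)
  ... | inj₁ nf      | inj₁ nfs     = inj₁ (nf ∷ nfs)
  ... | inj₁ _       | inj₂ (_ , r) = inj₂ (_ , there r)

⟶r⇒⇒r : ∀ {t T} → t ⟶r T → [ t ] ⇒r T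
⟶r⇒⇒r {T = T} r = subst ([ _ ] ⇒r_) (++-identityʳ T) (step [] [] r)

⇒r-++ʳ : ∀ {S S′} Q → S ⇒r S′ → (S ++ Q) ⇒r (S′ ++ Q)
⇒r-++ʳ Q (step S₁ S₂ {s} {T} r) =
  subst₂ _⇒r_ (sym (++-assoc S₁ (s ∷ S₂) Q))
    (sym (trans (++-assoc S₁ (T ++ S₂) Q) (cong (S₁ ++_) (++-assoc T S₂ Q))))
    (step S₁ (S₂ ++ Q) r)

⇒r-++ˡ : ∀ P {S S′} → S ⇒r S′ → (P ++ S) ⇒r (P ++ S′)
⇒r-++ˡ P (step S₁ S₂ {s} {T} r) =
  subst₂ _⇒r_ (++-assoc P S₁ (s ∷ S₂)) (++-assoc P S₁ (T ++ S₂)) (step (P ++ S₁) S₂ r)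

⇒r*-++ : ∀ {S S′ T T′} → S ⇒r* S′ → T ⇒r* T′ → (S ++ T) ⇒r* (S′ ++ T′)
⇒r*-++ {S′ = S′} {T} r q = gmap (_++ T) (⇒r-++ʳ T) r ◅◅ gmap (S′ ++_) (⇒r-++ˡ S′) q

⇒r*-map : ∀ (f : RTerm → RTerm) → (∀ {s T} → s ⟶r T → f s ⟶r map f T) →
          ∀ {S S′} → S ⇒r* S′ → map f S ⇒r* map f S′
⇒r*-map f f-⟶r = gmap (map f) λ where
  (step S₁ S₂ {s} {T} r) →
    subst₂ _⇒r_ (sym (map-++ f S₁ (s ∷ S₂)))
      (sym (trans (map-++ f S₁ (T ++ S₂)) (cong (map f S₁ ++_) (map-++ f T S₂))))
      (step (map f S₁) (map f S₂) (f-⟶r r))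

Normalizable : RSum → Set
Normalizable T = Σ RSum λ S → (T ⇒r* S) × NormalSum S

normalizable-++ : ∀ {S T} → Normalizable S → Normalizable T → Normalizable (S ++ T)
normalizable-++ (S′ , r , nf) (T′ , q , nf′) = S′ ++ T′ , ⇒r*-++ r q , ++⁺ nf nf′

normalizable-All : ∀ {P : RTerm → Set} → (∀ {u} → P u → Normalizable [ u ]) →
                   ∀ {T} → All P T → Normalizable T
normalizable-All h []       = [] , ε , []
normalizable-All h (p ∷ ps) = normalizable-++ (h p) (normalizable-All h ps)

normalizable-< : ∀ n t → size t < n → Normalizable [ t ]
normalizable-< (suc n) t (s≤s size≤n) with progress t
... | inj₁ nf = [ t ] , ε , nf ∷ []
... | inj₂ (T , r) with normalizable-All (normalizable-< n _)
                          (All.map (λ lt → <-≤-trans lt size≤n) (size-⟶r r))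
... | S , T⇒S , nf = S , ⟶r⇒⇒r r ◅ T⇒S , nf

normalizable : ∀ T → Normalizable T
normalizable []      = [] , ε , []
normalizable (t ∷ T) = normalizable-++ (normalizable-< (suc (size t)) t ≤-refl) (normalizable T)

NonZeroNF : RSum → Set
NonZeroNF L = Σ RSum λ S → ((L ⇒r* S) × NormalSum S) × S ≢ []

NFNonZero-∈ : ∀ {s L} → s ∈ L → NFNonZero s → NonZeroNF L
NFNonZero-∈ s∈L (S , (s⇒S , nf) , S≢[]) with ∈-∃++ s∈L
... | A , B , refl with normalizable A | normalizable B
... | A′ , A⇒A′ , nfA | B′ , B⇒B′ , nfB =
  A′ ++ S ++ B′ , (⇒r*-++ A⇒A′ (⇒r*-++ s⇒S B⇒B′) , ++⁺ nfA (++⁺ nf nfB)) ,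
  S≢[] ∘ ++-conicalˡ S B′ ∘ ++-conicalʳ A′ (S ++ B′)

NFNonZero-expand : ∀ {s T s′} → s ⟶r T → s′ ∈ T → NFNonZero s′ → NFNonZero s
NFNonZero-expand r s′∈T nz with NFNonZero-∈ s′∈T nz
... | S , (T⇒S , nf) , S≢[] = S , (⟶r⇒⇒r r ◅ T⇒S , nf) , S≢[]

redexFree⇒NFNonZero : ∀ {s} → RedexFree s → NFNonZero s
redexFree⇒NFNonZero nf = _ , (ε , nf ∷ []) , λ ()

NFNonZero-lam : ∀ {s} → NFNonZero s → NFNonZero (lam s)
NFNonZero-lam (S , (s⇒S , nf) , S≢[]) =
  map lam S , (⇒r*-map lam ξlam s⇒S , map⁺ (All.map lam nf)) , S≢[] ∘ map-≡[] S

appsR : RTerm → List Monomial → RTerm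
appsR s []         = s
appsR s (ts ∷ tss) = appsR (app s ts) tss

⟶r-appsR : ∀ tss {s T} → s ⟶r T → appsR s tss ⟶r map (λ u → appsR u tss) T
⟶r-appsR []         {T = T} r = subst (_ ⟶r_) (sym (map-id T)) r
⟶r-appsR (ts ∷ tss) {T = T} r = subst (_ ⟶r_) (sym (map-∘ T)) (⟶r-appsR tss (ξappL r))

substR-var-hit : ∀ {n k u} → (n ≡ᵇ k) ≡ true → substR k [ u ] (var n) ≡ [ u ]
substR-var-hit {n} {k} hit with n ≡ᵇ k | n <ᵇ k
substR-var-hit refl | true | _ = refl

substR-var-miss : ∀ {n k} → (n ≡ᵇ k) ≡ false →
                  substR k [] (var n) ≡ [ (if n <ᵇ k then var n else var (pred n)) ]
substR-var-miss {n} {k} miss with n ≡ᵇ k | n <ᵇ k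
substR-var-miss refl | false | true  = refl
substR-var-miss refl | false | false = refl

module _ {a : Level} {A : Set a} where

  ∈T*-if-var : ∀ b {m m′ s} → s ∈T* (if b then var {A = A} m else var m′) →
               s ≡ (if b then var m else var m′)
  ∈T*-if-var true  var = refl
  ∈T*-if-var false var = refl

  Args : List Monomial → List (ATerm A) → Set a
  Args = Pointwise (λ ts M → All (_∈T* M) ts)

  ∈T*-apps⁺ : ∀ {h H tss Ms} → h ∈T* H → Args tss Ms → appsR h tss ∈T* apps H Ms
  ∈T*-apps⁺ h∈H []         = h∈H
  ∈T*-apps⁺ h∈H (ts∈M ∷ a) = ∈T*-apps⁺ (app h∈H ts∈M) a

  ∈T*-apps⁻ : ∀ Ms {H s} → s ∈T* apps H Ms →
              ∃₂ λ h tss → h ∈T* H × Args tss Ms × s ≡ appsR h tss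
  ∈T*-apps⁻ []       s∈ = _ , [] , s∈ , [] , refl
  ∈T*-apps⁻ (M ∷ Ms) s∈ with ∈T*-apps⁻ Ms s∈
  ... | _ , tss , app h∈H ts∈M , a , refl = _ , _ ∷ tss , h∈H , ts∈M ∷ a , refl

  ∈T*-apps-redexFree : ∀ (Ms : List (ATerm A)) {h H} → h ∈T* H →
                       RedexFree h → (∀ {u} → h ≢ lam u) →
                       ∃ λ s → s ∈T* apps H Ms × RedexFree s
  ∈T*-apps-redexFree []       h∈H nf _    = _ , h∈H , nf
  ∈T*-apps-redexFree (M ∷ Ms) h∈H nf ¬lam =
    ∈T*-apps-redexFree Ms (app h∈H []) (app ¬lam nf []) λ ()

  mutual
    ∈T*-shiftA⁻ : ∀ c (N : ATerm A) {t} → t ∈T* shiftA c N → ∃ λ t₀ → t₀ ∈T* N × t ≡ shiftR c t₀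
    ∈T*-shiftA⁻ c (var n) t∈ = var n , var , ∈T*-if-var (n <ᵇ c) t∈
    ∈T*-shiftA⁻ c (lam N) (lam t∈) with ∈T*-shiftA⁻ (suc c) N t∈
    ... | _ , t₀∈ , refl = _ , lam t₀∈ , refl
    ∈T*-shiftA⁻ c (app M N) (app t∈ ts∈) with ∈T*-shiftA⁻ c M t∈ | All-∈T*-shiftA⁻ c N ts∈
    ... | _ , t₀∈ , refl | _ , ts₀∈ , refl = _ , app t₀∈ ts₀∈ , refl
    ∈T*-shiftA⁻ c (x · N) (scal t∈) with ∈T*-shiftA⁻ c N t∈
    ... | _ , t₀∈ , refl = _ , scal t₀∈ , refl
    ∈T*-shiftA⁻ c (M ⊕ N) (plusl t∈) with ∈T*-shiftA⁻ c M t∈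
    ... | _ , t₀∈ , refl = _ , plusl t₀∈ , refl
    ∈T*-shiftA⁻ c (M ⊕ N) (plusr t∈) with ∈T*-shiftA⁻ c N t∈
    ... | _ , t₀∈ , refl = _ , plusr t₀∈ , refl

    All-∈T*-shiftA⁻ : ∀ c (N : ATerm A) {ts} → All (_∈T* shiftA c N) ts →
                      ∃ λ ts₀ → All (_∈T* N) ts₀ × ts ≡ shiftRs c ts₀
    All-∈T*-shiftA⁻ c N [] = [] , [] , refl
    All-∈T*-shiftA⁻ c N (t∈ ∷ ts∈) with ∈T*-shiftA⁻ c N t∈ | All-∈T*-shiftA⁻ c N ts∈
    ... | _ , t₀∈ , refl | _ , ts₀∈ , refl = _ , t₀∈ ∷ ts₀∈ , refl

  mutual
    ∈T*-substA⁻ : ∀ S k N {s′} → s′ ∈T* substA k N S →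
                  ∃₂ λ s ts → s ∈T* S × All (_∈T* N) ts × s′ ∈ substR k ts s
    ∈T*-substA⁻ (var n) k N s′∈ with n ≡ᵇ k in eq
    ... | true  = var n , [ _ ] , var , s′∈ ∷ [] , subst (_ ∈_) (sym (substR-var-hit eq)) (here refl)
    ... | false = var n , [] , var , [] ,
                  subst (_ ∈_) (sym (substR-var-miss eq)) (here (∈T*-if-var (n <ᵇ k) s′∈))
    ∈T*-substA⁻ (lam S) k N (lam s′∈) with ∈T*-substA⁻ S (suc k) (shiftA 0 N) s′∈
    ... | s , _ , s∈S , ts∈ , s′∈s⟨ts⟩ with All-∈T*-shiftA⁻ 0 N ts∈
    ... | ts , ts∈N , refl = lam s , ts , lam s∈S , ts∈N , ∈-map⁺ lam s′∈s⟨ts⟩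
    ∈T*-substA⁻ (app M P) k N (app s′∈ us′∈) with ∈T*-substA⁻ M k N s′∈ | All-∈T*-substA⁻ P k N us′∈
    ... | s , ts , s∈M , ts∈N , s′∈s⟨ts⟩ | us , ts′ , us∈P , ts′∈N , us′∈us⟨ts′⟩ =
      app s us , ts ++ ts′ , app s∈M us∈P , ++⁺ ts∈N ts′∈N ,
      ∈-concatMap (∈-splits-++ ts ts′) (∈-concatMap-map app s′∈s⟨ts⟩ us′∈us⟨ts′⟩)
    ∈T*-substA⁻ (x · S) k N (scal s′∈) with ∈T*-substA⁻ S k N s′∈
    ... | s , ts , s∈S , rest = s , ts , scal s∈S , rest
    ∈T*-substA⁻ (M ⊕ P) k N (plusl s′∈) with ∈T*-substA⁻ M k N s′∈
    ... | s , ts , s∈M , rest = s , ts , plusl s∈M , rest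
    ∈T*-substA⁻ (M ⊕ P) k N (plusr s′∈) with ∈T*-substA⁻ P k N s′∈
    ... | s , ts , s∈P , rest = s , ts , plusr s∈P , rest

    All-∈T*-substA⁻ : ∀ S k N {us′} → All (_∈T* substA k N S) us′ →
                      ∃₂ λ us ts → All (_∈T* S) us × All (_∈T* N) ts × us′ ∈ substRs k ts us
    All-∈T*-substA⁻ S k N [] = [] , [] , [] , [] , here refl
    All-∈T*-substA⁻ S k N (u′∈ ∷ us′∈) with ∈T*-substA⁻ S k N u′∈ | All-∈T*-substA⁻ S k N us′∈
    ... | u , ts , u∈S , ts∈N , u′∈u⟨ts⟩ | us , ts′ , us∈S , ts′∈N , us′∈us⟨ts′⟩ =
      u ∷ us , ts ++ ts′ , u∈S ∷ us∈S , ++⁺ ts∈N ts′∈N ,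
      subst (_ ∈_) (sym (substRs-∷ k (ts ++ ts′) u us))
        (∈-concatMap (∈-splits-++ ts ts′) (∈-concatMap-map _∷_ u′∈u⟨ts⟩ us′∈us⟨ts′⟩))

  mutual
    ∈T*-resp-≈A : ∀ {M N : ATerm A} {s} → M ≈A N → s ∈T* M → s ∈T* N
    ∈T*-resp-≈A ≈refl        s∈ = s∈
    ∈T*-resp-≈A (≈sym e)     s∈ = ∈T*-resp-≈A˘ e s∈
    ∈T*-resp-≈A (≈trans e f) s∈ = ∈T*-resp-≈A f (∈T*-resp-≈A e s∈)
    ∈T*-resp-≈A (≈lam e)   (lam s∈)      = lam (∈T*-resp-≈A e s∈)
    ∈T*-resp-≈A (≈app e f) (app s∈ ts∈)  = app (∈T*-resp-≈A e s∈) (All.map (∈T*-resp-≈A f) ts∈)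
    ∈T*-resp-≈A (≈scal e)  (scal s∈)     = scal (∈T*-resp-≈A e s∈)
    ∈T*-resp-≈A (≈plus e f) (plusl s∈)   = plusl (∈T*-resp-≈A e s∈)
    ∈T*-resp-≈A (≈plus e f) (plusr s∈)   = plusr (∈T*-resp-≈A f s∈)
    ∈T*-resp-≈A lam-0 (lam ())
    ∈T*-resp-≈A lam-· (lam (scal s∈))     = scal (lam s∈)
    ∈T*-resp-≈A lam-⊕ (lam (plusl s∈))    = plusl (lam s∈)
    ∈T*-resp-≈A lam-⊕ (lam (plusr s∈))    = plusr (lam s∈)
    ∈T*-resp-≈A app-0 (app () _)
    ∈T*-resp-≈A app-· (app (scal s∈) ts∈)  = scal (app s∈ ts∈)
    ∈T*-resp-≈A app-⊕ (app (plusl s∈) ts∈) = plusl (app s∈ ts∈)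
    ∈T*-resp-≈A app-⊕ (app (plusr s∈) ts∈) = plusr (app s∈ ts∈)

    ∈T*-resp-≈A˘ : ∀ {M N : ATerm A} {s} → M ≈A N → s ∈T* N → s ∈T* M
    ∈T*-resp-≈A˘ ≈refl        s∈ = s∈
    ∈T*-resp-≈A˘ (≈sym e)     s∈ = ∈T*-resp-≈A e s∈
    ∈T*-resp-≈A˘ (≈trans e f) s∈ = ∈T*-resp-≈A˘ e (∈T*-resp-≈A˘ f s∈)
    ∈T*-resp-≈A˘ (≈lam e)   (lam s∈)      = lam (∈T*-resp-≈A˘ e s∈)
    ∈T*-resp-≈A˘ (≈app e f) (app s∈ ts∈)  = app (∈T*-resp-≈A˘ e s∈) (All.map (∈T*-resp-≈A˘ f) ts∈)
    ∈T*-resp-≈A˘ (≈scal e)  (scal s∈)     = scal (∈T*-resp-≈A˘ e s∈)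
    ∈T*-resp-≈A˘ (≈plus e f) (plusl s∈)   = plusl (∈T*-resp-≈A˘ e s∈)
    ∈T*-resp-≈A˘ (≈plus e f) (plusr s∈)   = plusr (∈T*-resp-≈A˘ f s∈)
    ∈T*-resp-≈A˘ lam-· (scal (lam s∈))     = lam (scal s∈)
    ∈T*-resp-≈A˘ lam-⊕ (plusl (lam s∈))    = lam (plusl s∈)
    ∈T*-resp-≈A˘ lam-⊕ (plusr (lam s∈))    = lam (plusr s∈)
    ∈T*-resp-≈A˘ app-· (scal (app s∈ ts∈))  = app (scal s∈) ts∈
    ∈T*-resp-≈A˘ app-⊕ (plusl (app s∈ ts∈)) = app (plusl s∈) ts∈
    ∈T*-resp-≈A˘ app-⊕ (plusr (app s∈ ts∈)) = app (plusr s∈) ts∈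

  WS⇒∃NFNonZero-∈T* : ∀ {M : ATerm A} → WS M → ∃ λ s → s ∈T* M × NFNonZero s
  WS⇒∃NFNonZero-∈T* (ws-head {x} {Ms}) with ∈T*-apps-redexFree Ms {H = var x} var var (λ ())
  ... | s , s∈ , nf = s , s∈ , redexFree⇒NFNonZero nf
  WS⇒∃NFNonZero-∈T* (ws-lam _ w) with WS⇒∃NFNonZero-∈T* w
  ... | s , s∈ , nz = lam s , lam s∈ , NFNonZero-lam nz
  WS⇒∃NFNonZero-∈T* (ws-β {S} {M₀} {Ms} _ w) with WS⇒∃NFNonZero-∈T* w
  ... | _ , s′∈ , nz with ∈T*-apps⁻ Ms s′∈
  ... | h , tss , h∈ , tss∈ , refl with ∈T*-substA⁻ S 0 M₀ h∈
  ... | s , ts , s∈S , ts∈M₀ , h∈s⟨ts⟩ =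
    appsR (app (lam s) ts) tss , ∈T*-apps⁺ (app (lam s∈S) ts∈M₀) tss∈ ,
    NFNonZero-expand (⟶r-appsR tss β) (∈-map⁺ _ h∈s⟨ts⟩) nz
  WS⇒∃NFNonZero-∈T* (ws-· w) with WS⇒∃NFNonZero-∈T* w
  ... | s , s∈ , nz = s , scal s∈ , nz
  WS⇒∃NFNonZero-∈T* (ws-⊕l w) with WS⇒∃NFNonZero-∈T* w
  ... | s , s∈ , nz = s , plusl s∈ , nz
  WS⇒∃NFNonZero-∈T* (ws-⊕r w) with WS⇒∃NFNonZero-∈T* w
  ... | s , s∈ , nz = s , plusr s∈ , nz
  WS⇒∃NFNonZero-∈T* (ws-≈ e w) with WS⇒∃NFNonZero-∈T* w
  ... | s , s∈ , nz = s , ∈T*-resp-≈A e s∈ , nz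

lemma9p4 : ∀ {c ℓ : Level} (𝒮 : CommutativeSemiring c ℓ)
           (M : ATerm (CommutativeSemiring.Carrier 𝒮)) →
           WS M → Σ RTerm (λ s → (s ∈T* M) × NFNonZero s)
lemma9p4 𝒮 M = WS⇒∃NFNonZero-∈T*
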